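{- If $P_n$ is the path on $n$ vertices, then the number of maximal multipackings of $P_n$ (multipackings not properly contained in any other multipacking of $P_n$) is $O(1.33^n)$.
   Context: For a graph $G=(V,E)$ with shortest-path distance $d$, $N_r[v]=\{u\in V:d(u,v)\le r\}$. A multipacking of $G$ is a set $M\subseteq V$ with $|N_r[v]\cap M|\le r$ for all $v\in V$ and all integers $r\ge1$. -}

module Defs where

open import Data.Nat using (ℕ; zero; suc; _+_; _≤_)
open import Data.Fin using (Fin; toℕ)
open import Data.Fin.Subset using (Subset; _∈_; _⊂_)
open import Data.List using (List; length)
open import Data.List.Relation.Unary.All using (All)
open import Data.List.Relation.Unary.Unique.Propositional using (Unique)
open import Data.Product using (Σ; _×_)
open import Data.Sum using (_⊎_)
open import Relation.Binary.PropositionalEquality using (_≡_)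
open import Relation.Nullary using (¬_)

Graph : ℕ → Set₁
Graph n = Fin n → Fin n → Set

PathGraph : (n : ℕ) → Graph n
PathGraph n u v = (suc (toℕ u) ≡ toℕ v) ⊎ (suc (toℕ v) ≡ toℕ u)

data Walk {n : ℕ} (G : Graph n) : Fin n → Fin n → ℕ → Set where
  here : ∀ {u} → Walk G u u 0
  step : ∀ {u w v k} → G u w → Walk G w v k → Walk G u v (suc k)

-- d(u,v) ≤ r for the shortest-path distance d: some walk of length ≤ r.
DistLe : {n : ℕ} → Graph n → Fin n → Fin n → ℕ → Set
DistLe G u v r = Σ ℕ λ k → k ≤ r × Walk G u v k

InBall : {n : ℕ} → Graph n → ℕ → Fin n → Fin n → Set
InBall G r v u = DistLe G u v r

-- M is a multipacking: for every v and r ≥ 1, |N_r[v] ∩ M| ≤ r,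
-- i.e. every duplicate-free list of vertices of N_r[v] ∩ M has length ≤ r.
IsMultipacking : {n : ℕ} → Graph n → Subset n → Set
IsMultipacking {n} G M =
  (v : Fin n) (r : ℕ) → 1 ≤ r →
  (xs : List (Fin n)) → Unique xs →
  All (λ u → u ∈ M × InBall G r v u) xs → length xs ≤ r

IsMaximalMultipacking : {n : ℕ} → Graph n → Subset n → Set
IsMaximalMultipacking {n} G M =
  IsMultipacking G M × ((M′ : Subset n) → IsMultipacking G M′ → ¬ (M ⊂ M′))

{-# OPTIONS --safe #-}
-- On a path a ball of radius r is an interval of 2r + 1 vertices, so a set is a
-- multipacking exactly when its members are pairwise at distance at least 3; if it is
-- maximal, every vertex also lies within distance 2 of a member, since otherwise it
-- could be added. Read as a bit string, a maximal multipacking thus has gaps of 3, 4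
-- or 5 between consecutive members (a count growing like the root ≈ 1.3247 of
-- x³ = x + 1), and is accepted by a five-state automaton counting the falses since the
-- last true. Weights on the states for which every letter costs at most a factor
-- 1.33 bound the number of accepted strings of length n by 65 · 1.33 ^ n.

module Submission where

open import Defs
open import Data.Bool using (Bool; true; false)
open import Data.Fin using (Fin; zero; suc; toℕ; fromℕ<) renaming (_≟_ to _≟ᶠ_)
open import Data.Fin.Properties using (toℕ-injective; toℕ-fromℕ<; toℕ<n; injective⇒≤)
open import Data.Fin.Subset using (Subset; _∈_; _∪_; ⁅_⁆)
open import Data.Fin.Subset.Properties using (p⊆p∪q; x∈p∪q⁺; x∈p∪q⁻; x∈⁅x⁆; x∈⁅y⁆⇒x≡y)
open import Data.List using (List; []; _∷_; [_]; length; map; _++_; lookup)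
open import Data.List.Properties using (length-map; length-++)
open import Data.List.Membership.Propositional using () renaming (_∈_ to _∈ₗ_)
open import Data.List.Membership.Propositional.Properties using (∈-lookup; ∈-map⁺; ∈-++⁺ˡ; ∈-++⁺ʳ)
open import Data.List.Relation.Unary.All as All using (All; []; _∷_)
open import Data.List.Relation.Unary.AllPairs using ([]; _∷_)
open import Data.List.Relation.Unary.Any using (here; index)
open import Data.List.Relation.Unary.Any.Properties using (lookup-index)
open import Data.List.Relation.Unary.Unique.Propositional using (Unique)
open import Data.Nat using (ℕ; zero; suc; _+_; _*_; _^_; _∸_; _/_; _≤_; _<_; z≤n; s≤s; z<s; ∣_-_∣)
open import Data.Nat.DivMod using (/-monoˡ-≤; m/n≡1+[m∸n]/n; m<n*o⇒m/o<n)
open import Data.Nat.Properties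
open import Algebra.Properties.CommutativeSemigroup +-commutativeSemigroup using (x∙yz≈y∙xz)
open import Data.Product using (Σ; ∃-syntax; _×_; _,_; proj₁; proj₂)
open import Data.Sum using (inj₁; inj₂)
open import Data.Unit using (tt)
open import Data.Vec using (Vec; []; _∷_; here; there)
open import Function using (_∘_)
open import Relation.Binary.Definitions using (tri<; tri≈; tri>)
open import Relation.Binary.PropositionalEquality using (_≡_; refl; sym; trans; cong; subst)
open import Relation.Nullary using (¬_; yes; no; contradiction)

module _ {a} {A : Set a} where

  lookup-injective : ∀ {xs : List A} → Unique xs → ∀ {i j} → lookup xs i ≡ lookup xs j → i ≡ j
  lookup-injective (_ ∷ _)      {zero}  {zero}  _  = refl
  lookup-injective (x∉xs ∷ _)   {zero}  {suc j} eq = contradiction eq (All.lookup x∉xs (∈-lookup j))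
  lookup-injective (x∉xs ∷ _)   {suc i} {zero}  eq =
    contradiction (sym eq) (All.lookup x∉xs (∈-lookup i))
  lookup-injective (_ ∷ unique) {suc i} {suc j} eq = cong suc (lookup-injective unique eq)

  injection⇒length≤ : ∀ {xs : List A} {m} → Unique xs → (f : ∀ {x} → x ∈ₗ xs → Fin m) →
                         (∀ {x y} (p : x ∈ₗ xs) (q : y ∈ₗ xs) → f p ≡ f q → x ≡ y) →
                         length xs ≤ m
  injection⇒length≤ unique f f-injective = injective⇒≤ {f = f ∘ ∈-lookup}
    (λ eq → lookup-injective unique (f-injective (∈-lookup _) (∈-lookup _) eq))

  Unique-⊆⇒length≤ : ∀ {xs ys : List A} → Unique xs → (∀ {x} → x ∈ₗ xs → x ∈ₗ ys) →
                     length xs ≤ length ys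
  Unique-⊆⇒length≤ {ys = ys} unique xs⊆ys =
    injection⇒length≤ unique (λ p → index (xs⊆ys p)) λ p q eq →
      trans (lookup-index (xs⊆ys p)) (trans (cong (lookup ys) eq) (sym (lookup-index (xs⊆ys q))))

∣-∣≤⇒≤+ : ∀ {m n k} → ∣ m - n ∣ ≤ k → m ≤ k + n
∣-∣≤⇒≤+ {m} {n} h = ≤-trans (m≤∣m-n∣+n m n) (+-monoˡ-≤ n h)

≤∣-∣⇒+≤ : ∀ {m n k} → m ≤ n → k ≤ ∣ m - n ∣ → k + m ≤ n
≤∣-∣⇒+≤ {m} {n} {k} m≤n h = begin
  k + m           ≤⟨ +-monoˡ-≤ m h ⟩
  ∣ m - n ∣ + m   ≡⟨ cong (_+ m) (m≤n⇒∣m-n∣≡n∸m m≤n) ⟩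
  n ∸ m + m       ≡⟨ m∸n+n≡m m≤n ⟩
  n               ∎
  where open ≤-Reasoning

∣m-1+m∣≡1 : ∀ m → ∣ m - suc m ∣ ≡ 1
∣m-1+m∣≡1 zero    = refl
∣m-1+m∣≡1 (suc m) = ∣m-1+m∣≡1 m

3+m≤n⇒m/3<n/3 : ∀ {m n} → 3 + m ≤ n → m / 3 < n / 3
3+m≤n⇒m/3<n/3 {m} 3+m≤n =
  ≤-trans (≤-reflexive (sym (m/n≡1+[m∸n]/n (m≤m+n 3 m)))) (/-monoˡ-≤ 3 3+m≤n)

module _ {n} {G : Graph n} where

  inBall-centre : ∀ {r v} → InBall G r v v
  inBall-centre = 0 , z≤n , here

  inBall-edge : ∀ {u v} → G u v → InBall G 1 v u
  inBall-edge uv = 1 , ≤-refl , step uv here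

  walk⇒∣-∣≤ : (f : Fin n → ℕ) → (∀ {u w} → G u w → ∣ f u - f w ∣ ≤ 1) →
              ∀ {u v k} → Walk G u v k → ∣ f u - f v ∣ ≤ k
  walk⇒∣-∣≤ f f-lipschitz {u} here = ≤-reflexive (∣n-n∣≡0 (f u))
  walk⇒∣-∣≤ f f-lipschitz (step {u} {w} {v} {k} uw wv) = begin
    ∣ f u - f v ∣                 ≤⟨ ∣-∣-triangle (f u) (f w) (f v) ⟩
    ∣ f u - f w ∣ + ∣ f w - f v ∣ ≤⟨ +-mono-≤ (f-lipschitz uw) (walk⇒∣-∣≤ f f-lipschitz wv) ⟩
    suc k                         ∎
    where open ≤-Reasoning

  multipacking-unit-ball : ∀ {M x y c} → IsMultipacking G M → x ∈ M → y ∈ M →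
                           InBall G 1 c x → InBall G 1 c y → x ≡ y
  multipacking-unit-ball {x = x} {y} {c} packing x∈M y∈M cx cy with x ≟ᶠ y
  ... | yes x≡y = x≡y
  ... | no  x≢y = contradiction
    (packing c 1 ≤-refl (x ∷ y ∷ []) ((x≢y ∷ []) ∷ [] ∷ []) ((x∈M , cx) ∷ (y∈M , cy) ∷ []))
    1+n≰n

path-edge⇒∣-∣≤1 : ∀ {n} {u w : Fin n} → PathGraph n u w → ∣ toℕ u - toℕ w ∣ ≤ 1
path-edge⇒∣-∣≤1 {u = u} (inj₁ 1+u≡w) =
  ≤-reflexive (subst (λ w → ∣ toℕ u - w ∣ ≡ 1) 1+u≡w (∣m-1+m∣≡1 (toℕ u)))
path-edge⇒∣-∣≤1 {w = w} (inj₂ 1+w≡u) =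
  ≤-reflexive (subst (λ u → ∣ u - toℕ w ∣ ≡ 1) 1+w≡u
                     (trans (∣-∣-comm (suc (toℕ w)) (toℕ w)) (∣m-1+m∣≡1 (toℕ w))))

path-inBall⇒∣-∣≤ : ∀ {n r} {v u : Fin n} → InBall (PathGraph n) r v u → ∣ toℕ u - toℕ v ∣ ≤ r
path-inBall⇒∣-∣≤ (k , k≤r , walk) = ≤-trans (walk⇒∣-∣≤ toℕ path-edge⇒∣-∣≤1 walk) k≤r

path-close-pair-centre : ∀ {n} {x y : Fin n} → toℕ x < toℕ y → toℕ y ≤ 2 + toℕ x →
                         ∃[ c ] InBall (PathGraph n) 1 c x × InBall (PathGraph n) 1 c y
path-close-pair-centre {n} {x} {y} x<y y≤2+x with m≤n⇒m<n∨m≡n y≤2+x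
... | inj₁ y<2+x = x , inBall-centre , inBall-edge (inj₂ (≤-antisym x<y (≤-pred y<2+x)))
... | inj₂ y≡2+x =
  c , inBall-edge (inj₁ (sym c≡1+x)) , inBall-edge (inj₂ (trans (cong suc c≡1+x) (sym y≡2+x)))
  where
  1+x<n : suc (toℕ x) < n
  1+x<n = <⇒≤ (subst (_< n) y≡2+x (toℕ<n y))
  c : Fin n
  c = fromℕ< 1+x<n
  c≡1+x : toℕ c ≡ suc (toℕ x)
  c≡1+x = toℕ-fromℕ< 1+x<n

Separated : ∀ {n} → Subset n → Set
Separated {n} M = ∀ {x y : Fin n} → x ∈ M → y ∈ M → toℕ x < toℕ y → 3 + toℕ x ≤ toℕ y

multipacking⇒separated : ∀ {n} {M : Subset n} → IsMultipacking (PathGraph n) M → Separated M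
multipacking⇒separated packing {x} {y} x∈M y∈M x<y with 3 + toℕ x ≤? toℕ y
... | yes 3+x≤y = 3+x≤y
... | no  3+x≰y with path-close-pair-centre x<y (≤-pred (≰⇒> 3+x≰y))
...   | c , cx , cy =
  contradiction (cong toℕ (multipacking-unit-ball packing x∈M y∈M cx cy)) (<⇒≢ x<y)

-- Each block of three consecutive vertices of the interval N_r[v] holds at most one
-- member, and the interval is covered by at most r such blocks.
separated⇒multipacking : ∀ {n} {M : Subset n} → Separated M → IsMultipacking (PathGraph n) M
separated⇒multipacking {n} {M} separated v r 1≤r xs unique members =
  injection⇒length≤ unique block block-injective
  where
  member : ∀ {x} → x ∈ₗ xs → x ∈ M
  member p = proj₁ (All.lookup members p)

  near : ∀ {x} → x ∈ₗ xs → ∣ toℕ x - toℕ v ∣ ≤ r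
  near p = path-inBall⇒∣-∣≤ (proj₂ (All.lookup members p))

  right-end : ∀ {x} → x ∈ₗ xs → toℕ x ≤ r + toℕ v
  right-end p = ∣-∣≤⇒≤+ (near p)

  left-end : ∀ {x} → x ∈ₗ xs → toℕ v ≤ r + toℕ x
  left-end {x} p = ∣-∣≤⇒≤+ (subst (_≤ r) (∣-∣-comm (toℕ x) (toℕ v)) (near p))

  offset : Fin n → ℕ
  offset x = r + toℕ x ∸ toℕ v

  block< : ∀ {x} → x ∈ₗ xs → offset x / 3 < r
  block< {x} p = m<n*o⇒m/o<n (begin-strict
    r + toℕ x ∸ toℕ v        ≤⟨ ∸-monoˡ-≤ (toℕ v) (+-monoʳ-≤ r (right-end p)) ⟩
    r + (r + toℕ v) ∸ toℕ v  ≡⟨ cong (_∸ toℕ v) (+-assoc r r (toℕ v)) ⟨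
    r + r + toℕ v ∸ toℕ v    ≡⟨ m+n∸n≡m (r + r) (toℕ v) ⟩
    r + r                    <⟨ +-monoʳ-< r (m<m+n r 1≤r) ⟩
    r + (r + r)              ≡⟨ cong (λ t → r + (r + t)) (+-identityʳ r) ⟨
    3 * r                    ≡⟨ *-comm 3 r ⟩
    r * 3                    ∎)
    where open ≤-Reasoning

  block : ∀ {x} → x ∈ₗ xs → Fin r
  block p = fromℕ< (block< p)

  block-increasing : ∀ {x y} (p : x ∈ₗ xs) (q : y ∈ₗ xs) → toℕ x < toℕ y →
                     toℕ (block p) < toℕ (block q)
  block-increasing {x} {y} p q x<y = begin-strict
    toℕ (block p)   ≡⟨ toℕ-fromℕ< (block< p) ⟩
    offset x / 3    <⟨ 3+m≤n⇒m/3<n/3 offset-gap ⟩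
    offset y / 3    ≡⟨ toℕ-fromℕ< (block< q) ⟨
    toℕ (block q)   ∎
    where
    open ≤-Reasoning
    3+x≤y : 3 + toℕ x ≤ toℕ y
    3+x≤y = separated (member p) (member q) x<y

    offset-gap : 3 + offset x ≤ offset y
    offset-gap = begin
      3 + (r + toℕ x ∸ toℕ v)  ≡⟨ +-∸-assoc 3 (left-end p) ⟨
      3 + (r + toℕ x) ∸ toℕ v  ≡⟨ cong (_∸ toℕ v) (x∙yz≈y∙xz 3 r (toℕ x)) ⟩
      r + (3 + toℕ x) ∸ toℕ v  ≤⟨ ∸-monoˡ-≤ (toℕ v) (+-monoʳ-≤ r 3+x≤y) ⟩
      r + toℕ y ∸ toℕ v        ∎

  block-injective : ∀ {x y} (p : x ∈ₗ xs) (q : y ∈ₗ xs) → block p ≡ block q → x ≡ y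
  block-injective {x} {y} p q eq with <-cmp (toℕ x) (toℕ y)
  ... | tri< x<y _ _ = contradiction (cong toℕ eq) (<⇒≢ (block-increasing p q x<y))
  ... | tri≈ _ x≡y _ = toℕ-injective x≡y
  ... | tri> _ _ y<x = contradiction (cong toℕ (sym eq)) (<⇒≢ (block-increasing q p y<x))

χ : ∀ {n} → Subset n → ℕ → Bool
χ []      _       = false
χ (b ∷ _) zero    = b
χ (_ ∷ M) (suc i) = χ M i

χ-∈ : ∀ {n} {M : Subset n} {x} → x ∈ M → χ M (toℕ x) ≡ true
χ-∈ here        = refl
χ-∈ (there x∈M) = χ-∈ x∈M

χ-true : ∀ {n} (M : Subset n) {i} → χ M i ≡ true → ∃[ x ] toℕ x ≡ i × x ∈ M
χ-true []         ()
χ-true (true ∷ M) {zero} refl = zero , refl , here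
χ-true (_ ∷ M) {suc i} Mi with χ-true M Mi
... | x , refl , x∈M = suc x , refl , there x∈M

window : (ℕ → Bool) → ℕ → (m : ℕ) → Vec Bool m
window G i zero    = []
window G i (suc m) = G i ∷ window G (suc i) m

window-suc : ∀ G i m → window G (suc i) m ≡ window (G ∘ suc) i m
window-suc G i zero    = refl
window-suc G i (suc m) = cong (G (suc i) ∷_) (window-suc G (suc i) m)

window-χ : ∀ {n} (M : Subset n) → window (χ M) 0 n ≡ M
window-χ []      = refl
window-χ (b ∷ M) = cong (b ∷_) (trans (window-suc (χ (b ∷ M)) 0 _) (window-χ M))

maximal⇒dominated : ∀ {n} {M : Subset n} → IsMaximalMultipacking (PathGraph n) M →
                    (p : Fin n) → ¬ (∀ q → ∣ toℕ p - q ∣ ≤ 2 → χ M q ≡ false)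
maximal⇒dominated {n} {M} (packing , maximal) p isolated = maximal (M ∪ ⁅ p ⁆)
  (separated⇒multipacking separated′) (p⊆p∪q ⁅ p ⁆ , p , x∈p∪q⁺ (inj₂ (x∈⁅x⁆ p)) , p∉M)
  where
  separated : Separated M
  separated = multipacking⇒separated packing

  χ≢false : ∀ {q} → q ∈ M → ¬ (χ M (toℕ q) ≡ false)
  χ≢false q∈M Mq = contradiction (trans (sym (χ-∈ q∈M)) Mq) λ ()

  p∉M : ¬ (p ∈ M)
  p∉M p∈M = χ≢false p∈M (isolated (toℕ p) (subst (_≤ 2) (sym (∣n-n∣≡0 (toℕ p))) z≤n))

  far : ∀ {y} → y ∈ M → 3 ≤ ∣ toℕ p - toℕ y ∣
  far {y} y∈M with 3 ≤? ∣ toℕ p - toℕ y ∣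
  ... | yes 3≤∣p-y∣ = 3≤∣p-y∣
  ... | no  3≰∣p-y∣ = contradiction (isolated (toℕ y) (≤-pred (≰⇒> 3≰∣p-y∣))) (χ≢false y∈M)

  separated′ : Separated (M ∪ ⁅ p ⁆)
  separated′ {x} {y} x∈ y∈ x<y with x∈p∪q⁻ M ⁅ p ⁆ x∈ | x∈p∪q⁻ M ⁅ p ⁆ y∈
  ... | inj₁ x∈M | inj₁ y∈M = separated x∈M y∈M x<y
  ... | inj₂ x∈p | inj₁ y∈M rewrite x∈⁅y⁆⇒x≡y p x∈p = ≤∣-∣⇒+≤ (<⇒≤ x<y) (far y∈M)
  ... | inj₁ x∈M | inj₂ y∈p rewrite x∈⁅y⁆⇒x≡y p y∈p =
    ≤∣-∣⇒+≤ (<⇒≤ x<y) (subst (3 ≤_) (∣-∣-comm (toℕ p) (toℕ x)) (far x∈M))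
  ... | inj₂ x∈p | inj₂ y∈p rewrite x∈⁅y⁆⇒x≡y p x∈p | x∈⁅y⁆⇒x≡y p y∈p =
    contradiction x<y (<-irrefl refl)

-- The bit strings accepted from state k by the automaton whose state counts the
-- falses read since the last true: reading a true needs k ≥ 2, a false needs k < 4.
accepted : (m k : ℕ) → List (Vec Bool m)
accepted zero    _ = [ [] ]
accepted (suc m) 0 = map (false ∷_) (accepted m 1)
accepted (suc m) 1 = map (false ∷_) (accepted m 2)
accepted (suc m) 2 = map (true ∷_) (accepted m 0) ++ map (false ∷_) (accepted m 3)
accepted (suc m) 3 = map (true ∷_) (accepted m 0) ++ map (false ∷_) (accepted m 4)
accepted (suc m) (suc (suc (suc (suc _)))) = map (true ∷_) (accepted m 0)

true∷∈accepted : ∀ {m k} {v : Vec Bool m} → 2 ≤ k → v ∈ₗ accepted m 0 →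
                 true ∷ v ∈ₗ accepted (suc m) k
true∷∈accepted {k = 1} (s≤s ()) _
true∷∈accepted {k = 2} _ v∈ = ∈-++⁺ˡ (∈-map⁺ (true ∷_) v∈)
true∷∈accepted {k = 3} _ v∈ = ∈-++⁺ˡ (∈-map⁺ (true ∷_) v∈)
true∷∈accepted {k = suc (suc (suc (suc _)))} _ v∈ = ∈-map⁺ (true ∷_) v∈

false∷∈accepted : ∀ {m k} {v : Vec Bool m} → k < 4 → v ∈ₗ accepted m (suc k) →
                  false ∷ v ∈ₗ accepted (suc m) k
false∷∈accepted {k = 0} _ v∈ = ∈-map⁺ (false ∷_) v∈
false∷∈accepted {k = 1} _ v∈ = ∈-map⁺ (false ∷_) v∈
false∷∈accepted {m} {k = 2} _ v∈ = ∈-++⁺ʳ (map (true ∷_) (accepted m 0)) (∈-map⁺ (false ∷_) v∈)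
false∷∈accepted {m} {k = 3} _ v∈ = ∈-++⁺ʳ (map (true ∷_) (accepted m 0)) (∈-map⁺ (false ∷_) v∈)
false∷∈accepted {k = suc (suc (suc (suc _)))} (s≤s (s≤s (s≤s (s≤s ())))) _

module Reading (G : ℕ → Bool) (n : ℕ)
  (separated : ∀ {i j} → G i ≡ true → G j ≡ true → i < j → 3 + i ≤ j)
  (dominated : ∀ {p} → p < n → ¬ (∀ q → ∣ p - q ∣ ≤ 2 → G q ≡ false)) where

  -- The k positions before i are false, up to two of them lying before 0;
  -- when k ≤ 1 they are preceded by a true.
  record Gap (i k : ℕ) : Set where
    field
      k≤2+i       : k ≤ 2 + i
      falses      : ∀ {j} → j < i → i ≤ k + j → G j ≡ false
      true-before : k ≤ 1 → ∃[ j ] suc k + j ≡ i × G j ≡ true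

  open Gap

  initial : Gap 0 2
  initial = record { k≤2+i = ≤-refl ; falses = λ () ; true-before = λ { (s≤s ()) } }

  true-needs-gap : ∀ {i k} → Gap i k → G i ≡ true → 2 ≤ k
  true-needs-gap {i} {k} gap Gi with 2 ≤? k
  ... | yes 2≤k = 2≤k
  ... | no  2≰k with true-before gap (≤-pred (≰⇒> 2≰k))
  ...   | j , refl , Gj =
    contradiction (≤-pred (+-cancelʳ-≤ j 3 (suc k) (separated Gj Gi (m<n+m j z<s)))) 2≰k

  after-true : ∀ {i} → G i ≡ true → Gap (suc i) 0
  after-true {i} Gi = record
    { k≤2+i       = z≤n
    ; falses      = λ j<1+i 1+i≤j → contradiction (<-≤-trans j<1+i 1+i≤j) (<-irrefl refl)
    ; true-before = λ _ → i , refl , Gi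
    }

  false-needs-room : ∀ {i k} → Gap i k → G i ≡ false → i < n → k < 4
  false-needs-room {i} {k} gap Gi i<n with 4 ≤? k
  ... | no  4≰k = ≰⇒> 4≰k
  ... | yes 4≤k with m≤n⇒∃[o]m+o≡n (+-cancelˡ-≤ 2 2 i (≤-trans 4≤k (k≤2+i gap)))
  ...   | p , refl = contradiction isolated (dominated (m+n≤o⇒n≤o 2 i<n))
    where
    isolated : ∀ q → ∣ p - q ∣ ≤ 2 → G q ≡ false
    isolated q p≈q with m≤n⇒m<n∨m≡n (∣-∣≤⇒≤+ (subst (_≤ 2) (∣-∣-comm p q) p≈q))
    ... | inj₁ q<i  = falses gap q<i (≤-trans (s≤s (s≤s (∣-∣≤⇒≤+ p≈q))) (+-monoˡ-≤ q 4≤k))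
    ... | inj₂ refl = Gi

  after-false : ∀ {i k} → Gap i k → G i ≡ false → Gap (suc i) (suc k)
  after-false {i} {k} gap Gi = record
    { k≤2+i       = s≤s (k≤2+i gap)
    ; falses      = falses′
    ; true-before = true-before′
    }
    where
    falses′ : ∀ {j} → j < suc i → suc i ≤ suc k + j → G j ≡ false
    falses′ j<1+i 1+i≤1+k+j with m<1+n⇒m<n∨m≡n j<1+i
    ... | inj₁ j<i  = falses gap j<i (≤-pred 1+i≤1+k+j)
    ... | inj₂ refl = Gi
    true-before′ : suc k ≤ 1 → ∃[ j ] suc (suc k) + j ≡ suc i × G j ≡ true
    true-before′ (s≤s z≤n) with true-before gap z≤n
    ... | j , 1+j≡i , Gj = j , cong suc 1+j≡i , Gj

  window∈accepted : ∀ m {i k} → m + i ≡ n → Gap i k → window G i m ∈ₗ accepted m k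
  window∈accepted zero    _ _ = here refl
  window∈accepted (suc m) {i} {k} 1+m+i≡n gap = read (G i) refl
    where
    m+1+i≡n : m + suc i ≡ n
    m+1+i≡n = trans (+-suc m i) 1+m+i≡n

    read : ∀ b → G i ≡ b → b ∷ window G (suc i) m ∈ₗ accepted (suc m) k
    read true  Gi = true∷∈accepted (true-needs-gap gap Gi)
                                   (window∈accepted m m+1+i≡n (after-true Gi))
    read false Gi = false∷∈accepted (false-needs-room gap Gi (subst (i <_) 1+m+i≡n (m<n+m i z<s)))
                                    (window∈accepted m m+1+i≡n (after-false gap Gi))

maximal⇒∈accepted : ∀ {n} {M : Subset n} → IsMaximalMultipacking (PathGraph n) M → M ∈ₗ accepted n 2
maximal⇒∈accepted {n} {M} maximal =
  subst (_∈ₗ accepted n 2) (window-χ M) (window∈accepted n (+-identityʳ n) initial)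
  where
  χ-separated : ∀ {i j} → χ M i ≡ true → χ M j ≡ true → i < j → 3 + i ≤ j
  χ-separated Mi Mj i<j with χ-true M Mi | χ-true M Mj
  ... | x , refl , x∈M | y , refl , y∈M = multipacking⇒separated (proj₁ maximal) x∈M y∈M i<j

  χ-dominated : ∀ {p} → p < n → ¬ (∀ q → ∣ p - q ∣ ≤ 2 → χ M q ≡ false)
  χ-dominated p<n = subst (λ p → ¬ (∀ q → ∣ p - q ∣ ≤ 2 → χ M q ≡ false)) (toℕ-fromℕ< p<n)
                          (maximal⇒dominated maximal (fromℕ< p<n))

  open Reading (χ M) n χ-separated χ-dominated

record LengthBound {a} {A : Set a} (c m : ℕ) (xs : List A) : Set where
  constructor lengthBound
  field
    bound : 100 ^ m * length xs ≤ c * 133 ^ m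

module _ {a} {A : Set a} where

  lengthBound-[x] : ∀ {c} {x : A} → 1 ≤ c → LengthBound c 0 [ x ]
  lengthBound-[x] 1≤c = lengthBound (*-monoˡ-≤ 1 1≤c)

  lengthBound-map : ∀ {b} {B : Set b} {c m} {xs : List A} (f : A → B) →
                    LengthBound c m xs → LengthBound c m (map f xs)
  lengthBound-map {m = m} {xs} f (lengthBound xs-bound) =
    lengthBound (subst (λ l → 100 ^ m * l ≤ _) (sym (length-map f xs)) xs-bound)

  lengthBound-++ : ∀ {c d m} {xs ys : List A} → LengthBound c m xs → LengthBound d m ys →
                   LengthBound (c + d) m (xs ++ ys)
  lengthBound-++ {c} {d} {m} {xs} {ys} (lengthBound xs-bound) (lengthBound ys-bound) =
    lengthBound (begin
      100 ^ m * length (xs ++ ys)               ≡⟨ cong (100 ^ m *_) (length-++ xs) ⟩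
      100 ^ m * (length xs + length ys)         ≡⟨ *-distribˡ-+ (100 ^ m) (length xs) (length ys) ⟩
      100 ^ m * length xs + 100 ^ m * length ys ≤⟨ +-mono-≤ xs-bound ys-bound ⟩
      c * 133 ^ m + d * 133 ^ m                 ≡⟨ *-distribʳ-+ (133 ^ m) c d ⟨
      (c + d) * 133 ^ m                         ∎)
    where open ≤-Reasoning

  lengthBound-suc : ∀ {c d m} {xs : List A} → 100 * c ≤ 133 * d →
                    LengthBound c m xs → LengthBound d (suc m) xs
  lengthBound-suc {c} {d} {m} {xs} 100c≤133d (lengthBound xs-bound) = lengthBound (begin
    100 * 100 ^ m * length xs     ≡⟨ *-assoc 100 (100 ^ m) (length xs) ⟩
    100 * (100 ^ m * length xs)   ≤⟨ *-monoʳ-≤ 100 xs-bound ⟩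
    100 * (c * 133 ^ m)           ≡⟨ *-assoc 100 c (133 ^ m) ⟨
    100 * c * 133 ^ m             ≤⟨ *-monoˡ-≤ (133 ^ m) 100c≤133d ⟩
    133 * d * 133 ^ m             ≡⟨ cong (_* 133 ^ m) (*-comm 133 d) ⟩
    d * 133 * 133 ^ m             ≡⟨ *-assoc d 133 (133 ^ m) ⟩
    d * (133 * 133 ^ m)           ∎)
    where open ≤-Reasoning

-- A weighting of the states with 100 · Σ (weights of the successors) ≤ 133 · weight.
weight : ℕ → ℕ
weight 0 = 37
weight 1 = 49
weight 2 = 65
weight 3 = 49
weight (suc (suc (suc (suc _)))) = 28

weight-positive : ∀ k → 1 ≤ weight k
weight-positive 0 = s≤s z≤n
weight-positive 1 = s≤s z≤n
weight-positive 2 = s≤s z≤n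
weight-positive 3 = s≤s z≤n
weight-positive (suc (suc (suc (suc _)))) = s≤s z≤n

accepted-bound : ∀ m k → LengthBound (weight k) m (accepted m k)
accepted-bound zero    k = lengthBound-[x] (weight-positive k)
accepted-bound (suc m) 0 = lengthBound-suc (≤ᵇ⇒≤ _ _ tt) (lengthBound-map _ (accepted-bound m 1))
accepted-bound (suc m) 1 = lengthBound-suc (≤ᵇ⇒≤ _ _ tt) (lengthBound-map _ (accepted-bound m 2))
accepted-bound (suc m) 2 = lengthBound-suc (≤ᵇ⇒≤ _ _ tt)
  (lengthBound-++ (lengthBound-map _ (accepted-bound m 0)) (lengthBound-map _ (accepted-bound m 3)))
accepted-bound (suc m) 3 = lengthBound-suc (≤ᵇ⇒≤ _ _ tt)
  (lengthBound-++ (lengthBound-map _ (accepted-bound m 0)) (lengthBound-map _ (accepted-bound m 4)))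
accepted-bound (suc m) (suc (suc (suc (suc _)))) =
  lengthBound-suc (≤ᵇ⇒≤ _ _ tt) (lengthBound-map _ (accepted-bound m 0))

proposition3 : Σ ℕ λ C → (n : ℕ) → (Ms : List (Subset n)) → Unique Ms →
                 All (IsMaximalMultipacking (PathGraph n)) Ms →
                 100 ^ n * length Ms ≤ C * 133 ^ n
proposition3 = weight 2 , λ n Ms unique maximal → begin
  100 ^ n * length Ms              ≤⟨ *-monoʳ-≤ (100 ^ n) (Unique-⊆⇒length≤ unique
                                        (maximal⇒∈accepted ∘ All.lookup maximal)) ⟩
  100 ^ n * length (accepted n 2)  ≤⟨ LengthBound.bound (accepted-bound n 2) ⟩
  weight 2 * 133 ^ n               ∎
  where open ≤-Reasoning
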